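{- There is an absolute constant $C>0$ such that for every connected graph $G=(V,E)$ with at least one edge, the slack matrix $S_G$ of the spanning tree polytope $P_{\mathrm{st}}(G)$ with respect to Edmonds' description satisfies $\mathrm{hsb}(S_G) \le C\,|E|$; that is, $\mathrm{hsb}(S_G) = O(|E|)$.
   Context: For a connected graph $G=(V,E)$, the spanning tree polytope is $P_{\mathrm{st}}(G) := \mathrm{conv}\{\chi(T)\in\{0,1\}^E : T\subseteq E \text{ is a spanning tree of } G\}$, where $\chi(T)$ is the incidence vector of $T$. Edmonds' description is $P_{\mathrm{st}}(G) = \{x\in\mathbb{R}^E_{\ge 0} : x(E) = |V|-1,\ x(E(U)) \le |U|-1 \text{ for all nonempty } U\subseteq V\}$, where $E(U)$ is the set of edges with both endpoints in $U$ and $x(F) := \sum_{e\in F}x_e$. The slack matrix $S_G$ with respect to this description has one row for each inequality $x_e\ge 0$ ($e\in E$) and one row for each inequality $x(E(U))\le |U|-1$ (nonempty $U\subseteq V$), and one column for each spanning tree $T$ of $G$; the entry is the slack of $\chi(T)$ in the inequality, i.e. $\chi(T)_e$ in row $x_e\ge0$, and $|U|-1-|T\cap E(U)|$ (which equals the number of connected components of $(U, T\cap E(U))$ minus one) in row $U$. For a real matrix $M=(m_{ij})$, $\|M\| := \max_{i,j} |m_{ij}|$; $\langle X,Y\rangle := \sum_{i,j} x_{ij}y_{ij}$. Let $\mathcal{R}_{m,n}$ be the set of rank-one matrices in $\{0,1\}^{m\times n}$. For a nonnegative $S\in\mathbb{R}^{m\times n}_{\ge0}$ not identically zero, $\mathrm{hsb}(S)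 := \|S\|^{ -1}\max\{\langle S,X\rangle : X\in\mathbb{R}^{m\times n},\ \langle X,R\rangle\le 1\ \forall R\in\mathcal{R}_{m,n}\}$.
   Formalization: The matrices $X$ in the definition of $\mathrm{hsb}(S_G)$ have only rational entries rather than real ones. -}

module Defs where

open import Data.Nat as ℕ using (ℕ; zero; suc; _∸_; _⊔_)
open import Data.Integer using (+_)
open import Data.Rational as ℚ using (ℚ; 0ℚ; 1ℚ)
open import Data.Bool using (Bool; true; false; _∧_; if_then_else_)
open import Data.Fin using (Fin)
open import Data.Fin.Subset using (Subset; _∈_; _-_; Nonempty; ∣_∣)
open import Data.Fin.Subset.Properties using (nonempty?)
open import Data.Vec using ([]; _∷_; lookup)
open import Data.List using (List; []; _∷_; map; _++_; foldr; filter; allFin; length)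
open import Data.List.Relation.Unary.Unique.Propositional using (Unique)
import Data.List.Membership.Propositional as LM
open import Data.Product using (_×_; _,_; proj₁; proj₂; ∃; Σ-syntax)
open import Data.Sum using (_⊎_; inj₁; inj₂)
open import Relation.Binary.PropositionalEquality using (_≡_; _≢_)
open import Relation.Nullary using (¬_)
open import Function.Bundles using (_⇔_)

record Graph (n m : ℕ) : Set where
  field
    ends     : Fin m → Fin n × Fin n
    loopless : ∀ e → proj₁ (ends e) ≢ proj₂ (ends e)
    noMulti  : ∀ e f → proj₁ (ends e) ≡ proj₁ (ends f) → proj₂ (ends e) ≡ proj₂ (ends f) → e ≡ f
    noMulti' : ∀ e f → proj₁ (ends e) ≡ proj₂ (ends f) → proj₂ (ends e) ≡ proj₁ (ends f) → e ≡ f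
open Graph public

Joins : ∀ {n m} → Graph n m → Fin m → Fin n → Fin n → Set
Joins G e u w = (ends G e ≡ (u , w)) ⊎ (ends G e ≡ (w , u))

data Reach {n m} (G : Graph n m) (F : Subset m) : Fin n → Fin n → Set where
  here : ∀ {u} → Reach G F u u
  step : ∀ {u w v} (e : Fin m) → e ∈ F → Joins G e u w → Reach G F w v → Reach G F u v

Connected : ∀ {n m} → Graph n m → Set
Connected {m = m} G = ∀ u v → Reach G (Data.Vec.replicate m true) u v
  where import Data.Vec

-- T is a spanning tree: (V,T) is connected and minimally so
-- (removing any edge of T disconnects its endpoints, i.e. T is acyclic).
IsSpanningTree : ∀ {n m} → Graph n m → Subset m → Set
IsSpanningTree G T =
  (∀ u v → Reach G T u v) ×
  (∀ e → e ∈ T → ¬ Reach G (T - e) (proj₁ (ends G e)) (proj₂ (ends G e)))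

count : ∀ {m} → (Fin m → Bool) → ℕ
count {m} p = foldr (λ e k → if p e then suc k else k) 0 (allFin m)

allSubsets : ∀ n → List (Subset n)
allSubsets zero    = [] ∷ []
allSubsets (suc n) = map (true ∷_) (allSubsets n) ++ map (false ∷_) (allSubsets n)

-- Rows of the slack matrix: edges (inequalities x_e ≥ 0) and nonempty
-- vertex sets U (inequalities x(E(U)) ≤ |U|-1).
Row : ℕ → ℕ → Set
Row n m = Fin m ⊎ Subset n

rows : ∀ n m → List (Row n m)
rows n m = map inj₁ (allFin m) ++ map inj₂ (filter nonempty? (allSubsets n))

edgesInside : ∀ {n m} → Graph n m → Subset n → Subset m → ℕ
edgesInside G U T = count (λ e → lookup T e ∧ (lookup U (proj₁ (ends G e)) ∧ lookup U (proj₂ (ends G e))))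

slack : ∀ {n m} → Graph n m → Row n m → Subset m → ℕ
slack G (inj₁ e) T = if lookup T e then 1 else 0
slack G (inj₂ U) T = (∣ U ∣ ∸ 1) ∸ edgesInside G U T

toℚ : ℕ → ℚ
toℚ k = (+ k) ℚ./ 1

sumℚ : ∀ {A : Set} → List A → (A → ℚ) → ℚ
sumℚ xs f = foldr (λ x q → f x ℚ.+ q) 0ℚ xs

inner : ∀ {R C : Set} → List R → List C → (R → C → ℚ) → (R → C → ℚ) → ℚ
inner rs cs X Y = sumℚ rs (λ i → sumℚ cs (λ j → X i j ℚ.* Y i j))

maxEntry : ∀ {R C : Set} → List R → List C → (R → C → ℕ) → ℕ
maxEntry rs cs M = foldr (λ i k → foldr (λ j l → M i j ⊔ l) k cs) 0 rs

outer : ∀ {R C : Set} → (R → Bool) → (C → Bool) → R → C → ℚ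
outer a b i j = if a i ∧ b j then 1ℚ else 0ℚ

-- X satisfies ⟨X,R⟩ ≤ 1 for every rank-one R ∈ {0,1}^{rs×cs}
-- (rank-one 0/1 matrices are exactly a bᵀ with a, b nonzero 0/1 vectors)
RankOneFeasible : ∀ {R C : Set} → List R → List C → (R → C → ℚ) → Set
RankOneFeasible {R} {C} rs cs X =
  (a : R → Bool) (b : C → Bool) →
  (∃ λ i → i LM.∈ rs × a i ≡ true) →
  (∃ λ j → j LM.∈ cs × b j ≡ true) →
  inner rs cs X (outer a b) ℚ.≤ 1ℚ

EnumeratesSpanningTrees : ∀ {n m} → Graph n m → List (Subset m) → Set
EnumeratesSpanningTrees G ts = Unique ts × (∀ T → (T LM.∈ ts) ⇔ IsSpanningTree G T)

{-# OPTIONS --safe #-}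

-- Every entry of the slack matrix is a sum of entries of a few 0/1 rank-one matrices
-- (rectangles), and a feasible X has ⟨R, X⟩ ≤ 1 for every rectangle R, so ⟨S_G, X⟩ is at
-- most the number of rectangles. The rows x_e ≥ 0 take one rectangle per edge. For a row U,
-- root each spanning tree T at a vertex r of U that depends on U only: every vertex of U
-- other than r has a unique parent edge, which lies either inside U or leaves U, so
-- |U| - 1 - |T ∩ E(U)| counts the tree edges leaving U from their child end. Rectangles
-- indexed by the root r and an oriented edge cover these rows, 2nm of them. Finally
-- ‖S_G‖ ≥ 1, and the vertices of even (of odd) depth in a rooted spanning tree span no tree
-- edge, so each class has at most ‖S_G‖ + 1 vertices; hence m + 2nm ≤ 9m‖S_G‖.

module Submission where

open import Defs

open import Algebra.Bundles using (CommutativeMonoid)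
open import Data.Bool as Bool using (Bool; true; false; _∧_; not; if_then_else_)
open import Data.Bool.Properties using (∧-zeroʳ; ∧-inverseˡ; not-involutive; ¬-not)
open import Data.Empty using (⊥-elim)
open import Data.Fin as Fin using (Fin; punchIn)
open import Data.Fin.Properties using (any?; punchInᵢ≢i; punchIn-injective; punchIn-punchOut)
  renaming (_≟_ to _≟ᶠ_)
open import Data.Fin.Subset using (Subset; ∣_∣; _∈_; _-_; ∁; Nonempty)
open import Data.Fin.Subset.Properties
  using (_∈?_; nonempty?; x∈p∧x∉q⇒x∈p─q; x≢y⇒x∉⁅y⁆; Empty-unique; ∣⊥∣≡0; ∣p∣≤n; ∣∁p∣≡n∸∣p∣)
import Data.Integer as ℤ
import Data.Integer.Properties as ℤP
open import Data.List using (List; []; _∷_; map; allFin; foldr; tabulate)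
open import Data.List.Membership.Propositional using (find; lose) renaming (_∈_ to _∈ₗ_)
open import Data.List.Membership.Propositional.Properties
  using (∈-++⁺ˡ; ∈-++⁺ʳ; ∈-map⁺; ∈-filter⁺; ∈-allFin)
open import Data.List.Relation.Unary.Any using (here; there)
import Data.List.Relation.Unary.Any as Any
open import Data.Maybe using (Maybe; just; nothing)
open import Data.Maybe.Properties using (just-injective) renaming (≡-dec to ≡-decᴹ)
open import Data.Nat
  using (ℕ; zero; suc; _+_; _*_; _∸_; _⊔_; _≤_; _<_; z≤n; s≤s; _≤′_; ≤′-refl; ≤′-step)
open import Data.Nat.Coprimality using (1-coprimeTo) renaming (sym to coprime-sym)
import Data.Nat.Properties as ℕP
open import Data.Nat.Tactic.RingSolver using (solve-∀)
open import Data.Product using (_×_; _,_; proj₁; proj₂; ∃; ∃-syntax; Σ-syntax; swap; <_,_>)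
open import Data.Product.Properties using (≡-dec; ,-injectiveˡ; ,-injectiveʳ)
open import Data.Rational as ℚ using (ℚ; 0ℚ; 1ℚ; mkℚ)
import Data.Rational.Properties as ℚP
open import Data.Sum using (_⊎_; inj₁; inj₂; [_,_])
open import Data.Vec using ([]; _∷_; lookup) renaming (tabulate to tabulateᵛ)
open import Data.Vec.Properties using ([]=⇒lookup; lookup⇒[]=; lookup∘tabulate; lookup-map)
  renaming (≡-dec to ≡-decᵛ)
open import Function using (_∘_; case_of_)
open import Function.Bundles using (Equivalence)
open import Relation.Binary.PropositionalEquality
  using (_≡_; _≢_; refl; sym; trans; cong; cong₂; subst; subst₂; module ≡-Reasoning)
open import Relation.Nullary using (Dec; yes; no; does; ¬_)
open import Relation.Nullary.Decidable using (dec-true; dec-false; _×-dec_; _⊎-dec_)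

open import Algebra.Properties.CommutativeMonoid.Sum ℕP.+-0-commutativeMonoid
  using (sum; sum-syntax; sum-remove; ∑-distrib-+; ∑-comm; sum-cong-≗; sum-replicate-zero)
open import Algebra.Properties.CommutativeSemigroup
  (CommutativeMonoid.commutativeSemigroup ℚP.+-0-commutativeMonoid) using (interchange)

𝟙 : Bool → ℕ
𝟙 b = if b then 1 else 0

sum-zero : ∀ {k} {f : Fin k → ℕ} → (∀ i → f i ≡ 0) → sum f ≡ 0
sum-zero {k} f≗0 = trans (sum-cong-≗ f≗0) (sum-replicate-zero k)

sum-point : ∀ {k} {f : Fin k → ℕ} (j : Fin k) → (∀ i → i ≢ j → f i ≡ 0) → sum f ≡ f j
sum-point {suc k} {f} j vanish = begin
  sum f                           ≡⟨ sum-remove f ⟩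
  f j + sum (f ∘ punchIn j)       ≡⟨ cong (f j +_) (sum-zero (λ i → vanish _ (punchInᵢ≢i j i))) ⟩
  f j + 0                         ≡⟨ ℕP.+-identityʳ (f j) ⟩
  f j                             ∎
  where open ≡-Reasoning

sum-pair : ∀ {k} {f : Fin k → ℕ} {x y : Fin k} → x ≢ y → (∀ i → i ≢ x → i ≢ y → f i ≡ 0) →
           sum f ≡ f x + f y
sum-pair {suc k} {f} {x} {y} x≢y vanish = begin
  sum f                           ≡⟨ sum-remove f ⟩
  f x + sum (f ∘ punchIn x)       ≡⟨ cong (f x +_) (sum-point (Fin.punchOut x≢y) vanish′) ⟩
  f x + f (punchIn x (Fin.punchOut x≢y)) ≡⟨ cong (λ v → f x + f v) (punchIn-punchOut x≢y) ⟩
  f x + f y                       ∎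
  where
  open ≡-Reasoning
  vanish′ : ∀ i → i ≢ Fin.punchOut x≢y → f (punchIn x i) ≡ 0
  vanish′ i i≢ = vanish _ (punchInᵢ≢i x i) λ eq →
    i≢ (punchIn-injective x i _ (trans eq (sym (punchIn-punchOut x≢y))))

sum-select : ∀ {k} (f : Fin k → Bool → ℕ) (j : Fin k) → (∀ i → f i false ≡ 0) →
             ∑[ i < k ] f i (does (j ≟ᶠ i)) ≡ f j true
sum-select f j f-false≡0 = trans
  (sum-point j (λ i i≢j → trans (cong (f i) (dec-false (j ≟ᶠ i) (i≢j ∘ sym))) (f-false≡0 i)))
  (cong (f j) (dec-true (j ≟ᶠ j) refl))

𝟙-split : ∀ b c → 𝟙 b ≡ 𝟙 (b ∧ c) + 𝟙 (b ∧ not c)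
𝟙-split true true = refl
𝟙-split true false = refl
𝟙-split false c = refl

𝟙-edge-split : ∀ t u₁ u₂ {p₁ p₂} → (p₁ ≡ t × p₂ ≡ false) ⊎ (p₁ ≡ false × p₂ ≡ t) →
               𝟙 (u₁ ∧ p₁) + 𝟙 (u₂ ∧ p₂) ≡
               𝟙 (t ∧ (u₁ ∧ u₂)) + (𝟙 ((u₁ ∧ not u₂) ∧ p₁) + 𝟙 ((u₂ ∧ not u₁) ∧ p₂))
𝟙-edge-split true  true  true  (inj₁ (refl , refl)) = refl
𝟙-edge-split true  true  false (inj₁ (refl , refl)) = refl
𝟙-edge-split true  false true  (inj₁ (refl , refl)) = refl
𝟙-edge-split true  false false (inj₁ (refl , refl)) = refl
𝟙-edge-split false true  true  (inj₁ (refl , refl)) = refl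
𝟙-edge-split false true  false (inj₁ (refl , refl)) = refl
𝟙-edge-split false false true  (inj₁ (refl , refl)) = refl
𝟙-edge-split false false false (inj₁ (refl , refl)) = refl
𝟙-edge-split true  true  true  (inj₂ (refl , refl)) = refl
𝟙-edge-split true  true  false (inj₂ (refl , refl)) = refl
𝟙-edge-split true  false true  (inj₂ (refl , refl)) = refl
𝟙-edge-split true  false false (inj₂ (refl , refl)) = refl
𝟙-edge-split false true  true  (inj₂ (refl , refl)) = refl
𝟙-edge-split false true  false (inj₂ (refl , refl)) = refl
𝟙-edge-split false false true  (inj₂ (refl , refl)) = refl
𝟙-edge-split false false false (inj₂ (refl , refl)) = refl

count≡sum : ∀ {k} (p : Fin k → Bool) → count p ≡ sum (𝟙 ∘ p)
count≡sum p = go p (λ i → i)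
  where
  go : ∀ {k l} (p : Fin l → Bool) (g : Fin k → Fin l) →
       foldr (λ e c → if p e then suc c else c) 0 (tabulate g) ≡ sum (𝟙 ∘ p ∘ g)
  go {zero} p g = refl
  go {suc k} p g with p (g Fin.zero)
  ... | true = cong suc (go p (g ∘ Fin.suc))
  ... | false = go p (g ∘ Fin.suc)

∣∣≡0 : ∀ {k} {U : Subset k} → ¬ Nonempty U → ∣ U ∣ ≡ 0
∣∣≡0 {k} U-empty = trans (cong ∣_∣ (Empty-unique U-empty)) (∣⊥∣≡0 k)

∣∣≡sum : ∀ {k} (U : Subset k) → ∣ U ∣ ≡ sum (λ v → 𝟙 (lookup U v))
∣∣≡sum [] = refl
∣∣≡sum (true ∷ U) = cong suc (∣∣≡sum U)
∣∣≡sum (false ∷ U) = ∣∣≡sum U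

toℚ≡mkℚ : ∀ k → toℚ k ≡ mkℚ (ℤ.+ k) 0 (coprime-sym (1-coprimeTo k))
toℚ≡mkℚ k = ℚP.normalize-coprime (coprime-sym (1-coprimeTo k))

toℚ-+ : ∀ a b → toℚ (a + b) ≡ toℚ a ℚ.+ toℚ b
toℚ-+ a b = trans
  (cong₂ (λ x y → (x ℤ.+ y) ℚ./ 1)
         (sym (ℤP.*-identityʳ (ℤ.+ a))) (sym (ℤP.*-identityʳ (ℤ.+ b))))
  (sym (cong₂ ℚ._+_ (toℚ≡mkℚ a) (toℚ≡mkℚ b)))

toℚ-* : ∀ a b → toℚ (a * b) ≡ toℚ a ℚ.* toℚ b
toℚ-* a b = trans (cong (ℚ._/ 1) (ℤP.pos-* a b)) (sym (cong₂ ℚ._*_ (toℚ≡mkℚ a) (toℚ≡mkℚ b)))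

toℚ-mono-≤ : ∀ {a b} → a ≤ b → toℚ a ℚ.≤ toℚ b
toℚ-mono-≤ {a} {b} a≤b rewrite toℚ≡mkℚ a | toℚ≡mkℚ b =
  ℚ.*≤* (subst₂ ℤ._≤_ (sym (ℤP.*-identityʳ (ℤ.+ a))) (sym (ℤP.*-identityʳ (ℤ.+ b)))
                      (ℤ.+≤+ a≤b))

toℚ-𝟙 : ∀ b → toℚ (𝟙 b) ≡ (if b then 1ℚ else 0ℚ)
toℚ-𝟙 true = refl
toℚ-𝟙 false = refl

module _ {A : Set} where

  sumℚ-cong : ∀ (xs : List A) {f g : A → ℚ} → (∀ {x} → x ∈ₗ xs → f x ≡ g x) →
              sumℚ xs f ≡ sumℚ xs g
  sumℚ-cong [] f≗g = refl
  sumℚ-cong (x ∷ xs) f≗g = cong₂ ℚ._+_ (f≗g (here refl)) (sumℚ-cong xs (f≗g ∘ there))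

  sumℚ-zero : ∀ (xs : List A) → sumℚ xs (λ _ → 0ℚ) ≡ 0ℚ
  sumℚ-zero [] = refl
  sumℚ-zero (x ∷ xs) = trans (ℚP.+-identityˡ _) (sumℚ-zero xs)

  sumℚ-+ : ∀ (xs : List A) (f g : A → ℚ) →
           sumℚ xs (λ x → f x ℚ.+ g x) ≡ sumℚ xs f ℚ.+ sumℚ xs g
  sumℚ-+ [] f g = refl
  sumℚ-+ (x ∷ xs) f g =
    trans (cong (f x ℚ.+ g x ℚ.+_) (sumℚ-+ xs f g)) (interchange (f x) (g x) (sumℚ xs f) (sumℚ xs g))

module InnerProductBound {R C : Set} (rs : List R) (cs : List C) (X : R → C → ℚ) where

  record InnerAtMost (S : R → C → ℕ) (k : ℕ) : Set where
    constructor innerAtMost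
    field inner≤ : inner rs cs (λ i j → toℚ (S i j)) X ℚ.≤ toℚ k
  open InnerAtMost public

  inner-+ : ∀ (S S′ : R → C → ℕ) →
            inner rs cs (λ i j → toℚ (S i j + S′ i j)) X ≡
            inner rs cs (λ i j → toℚ (S i j)) X ℚ.+ inner rs cs (λ i j → toℚ (S′ i j)) X
  inner-+ S S′ = begin
    sumℚ rs (term (λ i j → S i j + S′ i j))
      ≡⟨ sumℚ-cong rs (λ {i} _ → trans (sumℚ-cong cs (λ {j} _ → distrib i j))
                                       (sumℚ-+ cs (λ j → weighted S i j) (λ j → weighted S′ i j))) ⟩
    sumℚ rs (λ i → term S i ℚ.+ term S′ i)
      ≡⟨ sumℚ-+ rs (term S) (term S′) ⟩
    sumℚ rs (term S) ℚ.+ sumℚ rs (term S′) ∎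
    where
    open ≡-Reasoning
    weighted : (R → C → ℕ) → R → C → ℚ
    weighted S i j = toℚ (S i j) ℚ.* X i j
    term : (R → C → ℕ) → R → ℚ
    term S i = sumℚ cs (weighted S i)
    distrib : ∀ i j → weighted (λ i j → S i j + S′ i j) i j ≡ weighted S i j ℚ.+ weighted S′ i j
    distrib i j = trans (cong (ℚ._* X i j) (toℚ-+ (S i j) (S′ i j)))
                        (ℚP.*-distribʳ-+ (X i j) (toℚ (S i j)) (toℚ (S′ i j)))

  innerAtMost-zero : InnerAtMost (λ _ _ → 0) 0
  innerAtMost-zero = innerAtMost (ℚP.≤-reflexive (trans
    (sumℚ-cong rs (λ {i} _ → trans (sumℚ-cong cs (λ {j} _ → ℚP.*-zeroˡ (X i j))) (sumℚ-zero cs)))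
    (sumℚ-zero rs)))

  innerAtMost-+ : ∀ {S S′ k k′} → InnerAtMost S k → InnerAtMost S′ k′ →
                  InnerAtMost (λ i j → S i j + S′ i j) (k + k′)
  innerAtMost-+ {S} {S′} {k} {k′} (innerAtMost ≤k) (innerAtMost ≤k′) = innerAtMost
    (subst₂ ℚ._≤_ (sym (inner-+ S S′)) (sym (toℚ-+ k k′)) (ℚP.+-mono-≤ ≤k ≤k′))

  innerAtMost-∑ : ∀ {l k} {S : Fin l → R → C → ℕ} → (∀ t → InnerAtMost (S t) k) →
                  InnerAtMost (λ i j → ∑[ t < l ] S t i j) (l * k)
  innerAtMost-∑ {zero} ≤k = innerAtMost-zero
  innerAtMost-∑ {suc l} ≤k = innerAtMost-+ (≤k Fin.zero) (innerAtMost-∑ (≤k ∘ Fin.suc))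

  innerAtMost-cong : ∀ {S S′ k} → (∀ {i} → i ∈ₗ rs → ∀ {j} → j ∈ₗ cs → S i j ≡ S′ i j) →
                     InnerAtMost S k → InnerAtMost S′ k
  innerAtMost-cong S≗S′ (innerAtMost ≤k) = innerAtMost (subst (ℚ._≤ _)
    (sumℚ-cong rs (λ i∈ → sumℚ-cong cs (λ j∈ → cong (λ s → toℚ s ℚ.* _) (S≗S′ i∈ j∈)))) ≤k)

  innerAtMost-mono : ∀ {S k k′} → k ≤ k′ → InnerAtMost S k → InnerAtMost S k′
  innerAtMost-mono k≤k′ (innerAtMost ≤k) = innerAtMost (ℚP.≤-trans ≤k (toℚ-mono-≤ k≤k′))

  inner-outer-vanishing : ∀ (a : R → Bool) (b : C → Bool) →
                          (∀ {i} → i ∈ₗ rs → ∀ {j} → j ∈ₗ cs → a i ∧ b j ≡ false) →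
                          inner rs cs X (outer a b) ≡ 0ℚ
  inner-outer-vanishing a b ab≡false = trans
    (sumℚ-cong rs (λ i∈ → trans (sumℚ-cong cs (λ j∈ → vanish (ab≡false i∈ j∈))) (sumℚ-zero cs)))
    (sumℚ-zero rs)
    where
    vanish : ∀ {i j} → a i ∧ b j ≡ false → X i j ℚ.* outer a b i j ≡ 0ℚ
    vanish {i} {j} eq =
      trans (cong (λ c → X i j ℚ.* (if c then 1ℚ else 0ℚ)) eq) (ℚP.*-zeroʳ (X i j))

  innerAtMost-rankOne : RankOneFeasible rs cs X → ∀ (a : R → Bool) (b : C → Bool) →
                        InnerAtMost (λ i j → 𝟙 (a i ∧ b j)) 1
  innerAtMost-rankOne feasible a b = innerAtMost (subst (ℚ._≤ 1ℚ)
    (sym (sumℚ-cong rs (λ {i} _ → sumℚ-cong cs (λ {j} _ → commute i j)))) outer≤1)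
    where
    commute : ∀ i j → toℚ (𝟙 (a i ∧ b j)) ℚ.* X i j ≡ X i j ℚ.* outer a b i j
    commute i j = trans (ℚP.*-comm _ (X i j)) (cong (X i j ℚ.*_) (toℚ-𝟙 (a i ∧ b j)))
    0≤1 : 0ℚ ℚ.≤ 1ℚ
    0≤1 = toℚ-mono-≤ {0} {1} z≤n
    outer≤1 : inner rs cs X (outer a b) ℚ.≤ 1ℚ
    outer≤1 with Any.any? (λ i → a i Bool.≟ true) rs | Any.any? (λ j → b j Bool.≟ true) cs
    ... | yes ∃a | yes ∃b = feasible a b (find ∃a) (find ∃b)
    ... | no ∄a | _ = subst (ℚ._≤ 1ℚ) (sym (inner-outer-vanishing a b
          (λ i∈ _ → cong (_∧ _) (¬-not (∄a ∘ lose i∈))))) 0≤1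
    ... | yes _ | no ∄b = subst (ℚ._≤ 1ℚ) (sym (inner-outer-vanishing a b
          (λ _ j∈ → trans (cong (_ ∧_) (¬-not (∄b ∘ lose j∈))) (∧-zeroʳ _)))) 0≤1

module _ {A B : Set} {a c : A} {b d : B} where

  ,-injective : (a , b) ≡ (c , d) → a ≡ c × b ≡ d
  ,-injective = < ,-injectiveˡ , ,-injectiveʳ >

module _ {n m} (G : Graph n m) where

  Joins-sym : ∀ {e u w} → Joins G e u w → Joins G e w u
  Joins-sym (inj₁ eq) = inj₂ eq
  Joins-sym (inj₂ eq) = inj₁ eq

  Joins? : ∀ e u w → Dec (Joins G e u w)
  Joins? e u w = ≡-dec _≟ᶠ_ _≟ᶠ_ (ends G e) (u , w) ⊎-dec ≡-dec _≟ᶠ_ _≟ᶠ_ (ends G e) (w , u)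

  Joins-unique : ∀ {e u w u′ w′} → Joins G e u w → Joins G e u′ w′ →
                 (u ≡ u′ × w ≡ w′) ⊎ (u ≡ w′ × w ≡ u′)
  Joins-unique (inj₁ p) (inj₁ q) = inj₁ (,-injective (trans (sym p) q))
  Joins-unique (inj₁ p) (inj₂ q) = inj₂ (,-injective (trans (sym p) q))
  Joins-unique (inj₂ p) (inj₁ q) = inj₂ (swap (,-injective (trans (sym p) q)))
  Joins-unique (inj₂ p) (inj₂ q) = inj₁ (swap (,-injective (trans (sym p) q)))

  source target : Fin m → Bool → Fin n
  source e true = proj₁ (ends G e)
  source e false = proj₂ (ends G e)
  target e true = proj₂ (ends G e)
  target e false = proj₁ (ends G e)

  isInnerEdge : Subset n → Subset m → Fin m → Bool
  isInnerEdge U T e = lookup T e ∧ (lookup U (proj₁ (ends G e)) ∧ lookup U (proj₂ (ends G e)))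

  edgesInside≡∑ : ∀ U T → edgesInside G U T ≡ ∑[ e < m ] 𝟙 (isInnerEdge U T e)
  edgesInside≡∑ U T = count≡sum (isInnerEdge U T)

  edgesInside-vanishing : ∀ U T → (∀ e → lookup T e ≡ true →
                            lookup U (proj₁ (ends G e)) ∧ lookup U (proj₂ (ends G e)) ≡ false) →
                          edgesInside G U T ≡ 0
  edgesInside-vanishing U T no-inner-edge = trans (edgesInside≡∑ U T) (sum-zero vanish)
    where
    vanish : ∀ e → 𝟙 (isInnerEdge U T e) ≡ 0
    vanish e with lookup T e in e∈T
    ... | true = cong 𝟙 (no-inner-edge e e∈T)
    ... | false = refl

module _ {n m} {G : Graph n m} where

  Reach-trans : ∀ {F u v w} → Reach G F u v → Reach G F v w → Reach G F u w
  Reach-trans here q = q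
  Reach-trans (step e e∈F joins p) q = step e e∈F joins (Reach-trans p q)

  Reach-sym : ∀ {F u v} → Reach G F u v → Reach G F v u
  Reach-sym here = here
  Reach-sym (step e e∈F joins p) = Reach-trans (Reach-sym p) (step e e∈F (Joins-sym G joins) here)

  Reach-distinct⇒edge : ∀ {F u v} → u ≢ v → Reach G F u v → ∃[ e ] lookup F e ≡ true
  Reach-distinct⇒edge u≢u here = ⊥-elim (u≢u refl)
  Reach-distinct⇒edge _ (step e e∈F _ _) = e , []=⇒lookup e∈F

isEven : ℕ → Bool
isEven zero = true
isEven (suc k) = not (isEven k)

module RootedTree {n m} {G : Graph n m} {T : Subset m} (tree : IsSpanningTree G T) (r : Fin n) where

  Within : ℕ → Fin n → Set
  Within zero v = v ≡ r
  Within (suc k) v = Within k v ⊎ ∃[ e ] (e ∈ T × ∃[ u ] (Joins G e v u × Within k u))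

  Within? : ∀ k v → Dec (Within k v)
  Within? zero v = v ≟ᶠ r
  Within? (suc k) v =
    Within? k v ⊎-dec any? (λ e → (e ∈? T) ×-dec any? (λ u → Joins? G e v u ×-dec Within? k u))

  Within-mono : ∀ {j k v} → j ≤′ k → Within j v → Within k v
  Within-mono ≤′-refl w = w
  Within-mono (≤′-step j≤k) w = inj₁ (Within-mono j≤k w)

  Reach⇒Within : ∀ {v} → Reach G T v r → ∃[ k ] Within k v
  Reach⇒Within here = 0 , refl
  Reach⇒Within (step e e∈T joins rest) =
    let k , w = Reach⇒Within rest in suc k , inj₂ (e , e∈T , _ , joins , w)

  least : ∀ {v} k → Within k v → Σ[ d ∈ ℕ ] (Within d v × ∀ {j} → Within j v → d ≤ j)
  least zero w = zero , w , λ _ → z≤n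
  least {v} (suc k) w with Within? k v
  ... | yes w′ = least k w′
  ... | no ¬w = suc k , w , λ w′ → ℕP.≰⇒> λ j≤k → ¬w (Within-mono (ℕP.≤⇒≤′ j≤k) w′)

  shortest : ∀ v → Σ[ d ∈ ℕ ] (Within d v × ∀ {j} → Within j v → d ≤ j)
  shortest v = least _ (proj₂ (Reach⇒Within (proj₁ tree v r)))

  depth : Fin n → ℕ
  depth v = proj₁ (shortest v)

  depth-within : ∀ v → Within (depth v) v
  depth-within v = proj₁ (proj₂ (shortest v))

  depth-minimal : ∀ {j v} → Within j v → depth v ≤ j
  depth-minimal {v = v} = proj₂ (proj₂ (shortest v))

  depth-≤-suc : ∀ {e v u} → e ∈ T → Joins G e v u → depth v ≤ suc (depth u)
  depth-≤-suc e∈T joins = depth-minimal (inj₂ (_ , e∈T , _ , joins , depth-within _))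

  ParentEdge : Fin n → Fin m → Set
  ParentEdge v e = e ∈ T × ∃[ u ] (Joins G e v u × suc (depth u) ≡ depth v)

  parentEdge : ∀ {v} → v ≢ r → ∃ (ParentEdge v)
  parentEdge {v} v≢r = go (depth v) refl (depth-within v)
    where
    go : ∀ k → depth v ≡ k → Within k v → ∃ (ParentEdge v)
    go zero _ v≡r = ⊥-elim (v≢r v≡r)
    go (suc k) d≡ (inj₁ w) = ⊥-elim (ℕP.1+n≰n (subst (_≤ k) d≡ (depth-minimal w)))
    go (suc k) d≡ (inj₂ (e , e∈T , u , joins , w)) = e , e∈T , u , joins ,
      ℕP.≤-antisym (subst (suc (depth u) ≤_) (sym d≡) (s≤s (depth-minimal w)))
                   (depth-≤-suc e∈T joins)

  parent : Fin n → Maybe (Fin m)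
  parent v with v ≟ᶠ r
  ... | yes _ = nothing
  ... | no v≢r = just (proj₁ (parentEdge v≢r))

  parent-root : parent r ≡ nothing
  parent-root with r ≟ᶠ r
  ... | yes _ = refl
  ... | no r≢r = ⊥-elim (r≢r refl)

  parent-nonroot : ∀ {v} → v ≢ r → ∃[ e ] parent v ≡ just e
  parent-nonroot {v} v≢r with v ≟ᶠ r
  ... | yes v≡r = ⊥-elim (v≢r v≡r)
  ... | no _ = _ , refl

  parent-sound : ∀ {v e} → parent v ≡ just e → ParentEdge v e
  parent-sound {v} p with v ≟ᶠ r | p
  ... | no v≢r | refl = proj₂ (parentEdge v≢r)

  parent-injective : ∀ {v w e} → parent v ≡ just e → parent w ≡ just e → v ≡ w
  parent-injective p q with parent-sound p | parent-sound q
  ... | _ , u , joins , du | _ , u′ , joins′ , du′ with Joins-unique G joins joins′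
  ...   | inj₁ (v≡w , _) = v≡w
  ...   | inj₂ (refl , refl) = ⊥-elim (ℕP.<-asym (ℕP.≤-reflexive du) (ℕP.≤-reflexive du′))

  reach-root-avoiding : ∀ {e} → (∀ v → parent v ≢ just e) → ∀ v → Reach G (T - e) v r
  reach-root-avoiding {e} not-parent v = go (depth v) v refl
    where
    go : ∀ k v → depth v ≡ k → Reach G (T - e) v r
    go zero v d≡0 with subst (λ k → Within k v) d≡0 (depth-within v)
    ... | refl = here
    go (suc k) v d≡ with v ≟ᶠ r
    ... | yes refl = here
    ... | no v≢r with parent-nonroot v≢r
    ...   | e′ , p with parent-sound p
    ...     | e′∈T , u , joins , du =
      step e′ e′∈T-e joins (go k u (ℕP.suc-injective (trans du d≡)))
      where
      e′∈T-e : e′ ∈ T - e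
      e′∈T-e = x∈p∧x∉q⇒x∈p─q e′∈T (x≢y⇒x∉⁅y⁆ λ { refl → not-parent v p })

  -- If e were nobody's parent edge, every vertex would reach r in T - e, so e would lie on a cycle.
  parent-surjective : ∀ {e} → e ∈ T → ∃[ v ] parent v ≡ just e
  parent-surjective {e} e∈T with any? (λ v → ≡-decᴹ _≟ᶠ_ (parent v) (just e))
  ... | yes found = found
  ... | no none = ⊥-elim (proj₂ tree e e∈T (Reach-trans (to-root _) (Reach-sym (to-root _))))
    where
    to-root : ∀ v → Reach G (T - e) v r
    to-root = reach-root-avoiding (λ v p → none (v , p))

  depth-adjacent : ∀ {e} → e ∈ T →
                   suc (depth (proj₁ (ends G e))) ≡ depth (proj₂ (ends G e)) ⊎
                   suc (depth (proj₂ (ends G e))) ≡ depth (proj₁ (ends G e))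
  depth-adjacent e∈T with parent-surjective e∈T
  ... | _ , p with parent-sound p
  ...   | _ , _ , joins , du with Joins-unique G joins (inj₁ refl)
  ...     | inj₁ (refl , refl) = inj₂ du
  ...     | inj₂ (refl , refl) = inj₁ du

  evenDepth : Subset n
  evenDepth = tabulateᵛ (isEven ∘ depth)

  isEven-depth-adjacent : ∀ {e} → e ∈ T →
                          isEven (depth (proj₁ (ends G e))) ≡ not (isEven (depth (proj₂ (ends G e))))
  isEven-depth-adjacent e∈T with depth-adjacent e∈T
  ... | inj₁ du = trans (sym (not-involutive _)) (cong (not ∘ isEven) du)
  ... | inj₂ du = cong isEven (sym du)

  edgesInside-evenDepth : edgesInside G evenDepth T ≡ 0
  edgesInside-evenDepth = edgesInside-vanishing G evenDepth T vanish
    where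
    vanish : ∀ e → lookup T e ≡ true →
             lookup evenDepth (proj₁ (ends G e)) ∧ lookup evenDepth (proj₂ (ends G e)) ≡ false
    vanish e e∈T = begin
      lookup evenDepth x ∧ lookup evenDepth y
        ≡⟨ cong₂ _∧_ (lookup∘tabulate (isEven ∘ depth) x) (lookup∘tabulate (isEven ∘ depth) y) ⟩
      isEven (depth x) ∧ isEven (depth y)
        ≡⟨ cong (_∧ isEven (depth y)) (isEven-depth-adjacent (lookup⇒[]= e T e∈T)) ⟩
      not (isEven (depth y)) ∧ isEven (depth y)
        ≡⟨ ∧-inverseˡ (isEven (depth y)) ⟩
      false ∎
      where
      open ≡-Reasoning
      x y : Fin n
      x = proj₁ (ends G e)
      y = proj₂ (ends G e)

  edgesInside-oddDepth : edgesInside G (∁ evenDepth) T ≡ 0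
  edgesInside-oddDepth = edgesInside-vanishing G (∁ evenDepth) T vanish
    where
    odd : ∀ v → lookup (∁ evenDepth) v ≡ not (isEven (depth v))
    odd v = trans (lookup-map v not evenDepth) (cong not (lookup∘tabulate (isEven ∘ depth) v))
    vanish : ∀ e → lookup T e ≡ true →
             lookup (∁ evenDepth) (proj₁ (ends G e)) ∧ lookup (∁ evenDepth) (proj₂ (ends G e)) ≡ false
    vanish e e∈T = begin
      lookup (∁ evenDepth) x ∧ lookup (∁ evenDepth) y
        ≡⟨ cong₂ _∧_ (odd x) (odd y) ⟩
      not (isEven (depth x)) ∧ not (isEven (depth y))
        ≡⟨ cong (λ b → not b ∧ not (isEven (depth y))) (isEven-depth-adjacent (lookup⇒[]= e T e∈T)) ⟩
      not (not (isEven (depth y))) ∧ not (isEven (depth y))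
        ≡⟨ ∧-inverseˡ (not (isEven (depth y))) ⟩
      false ∎
      where
      open ≡-Reasoning
      x y : Fin n
      x = proj₁ (ends G e)
      y = proj₂ (ends G e)

  isParentEdge : Fin n → Fin m → Bool
  isParentEdge v e = does (≡-decᴹ _≟ᶠ_ (parent v) (just e))

  isParentEdge-true : ∀ {v e} → parent v ≡ just e → isParentEdge v e ≡ true
  isParentEdge-true {v} {e} = dec-true (≡-decᴹ _≟ᶠ_ (parent v) (just e))

  isParentEdge-false : ∀ {v e} → parent v ≢ just e → isParentEdge v e ≡ false
  isParentEdge-false {v} {e} = dec-false (≡-decᴹ _≟ᶠ_ (parent v) (just e))

  parent-endpoint : ∀ {v e} → parent v ≡ just e → v ≡ proj₁ (ends G e) ⊎ v ≡ proj₂ (ends G e)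
  parent-endpoint p with parent-sound p
  ... | _ , _ , joins , _ with Joins-unique G joins (inj₁ refl)
  ...   | inj₁ (v≡x , _) = inj₁ v≡x
  ...   | inj₂ (v≡y , _) = inj₂ v≡y

  isParentEdge-endpoints : ∀ e →
    (isParentEdge (source G e true) e ≡ lookup T e × isParentEdge (source G e false) e ≡ false) ⊎
    (isParentEdge (source G e true) e ≡ false × isParentEdge (source G e false) e ≡ lookup T e)
  isParentEdge-endpoints e with lookup T e in e∈?T
  ... | false = inj₁ (not-in-tree (source G e true) , not-in-tree (source G e false))
    where
    not-in-tree : ∀ v → isParentEdge v e ≡ false
    not-in-tree v = isParentEdge-false {v} λ p →
      case trans (sym ([]=⇒lookup (proj₁ (parent-sound p)))) e∈?T of λ ()
  ... | true with parent-surjective (lookup⇒[]= e T e∈?T)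
  ...   | v , p with parent-endpoint p
  ...     | inj₁ refl =
    inj₁ (isParentEdge-true p , isParentEdge-false λ q → loopless G e (parent-injective p q))
  ...     | inj₂ refl =
    inj₂ (isParentEdge-false (λ q → loopless G e (parent-injective q p)) , isParentEdge-true p)

  parentEdge-count : ∀ v → ∑[ e < m ] 𝟙 (isParentEdge v e) ≡ 𝟙 (not (does (r ≟ᶠ v)))
  parentEdge-count v with r ≟ᶠ v
  ... | yes refl = sum-zero λ e →
    cong 𝟙 (isParentEdge-false {r} {e} λ p → case trans (sym parent-root) p of λ ())
  ... | no r≢v with parent-nonroot (r≢v ∘ sym)
  ...   | e₀ , p = trans
          (sum-point e₀ λ e e≢e₀ →
            cong 𝟙 (isParentEdge-false {v} {e} λ q → e≢e₀ (just-injective (trans (sym q) p))))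
          (cong 𝟙 (isParentEdge-true p))

  childIn : Subset n → Fin n → Fin m → ℕ
  childIn U v e = 𝟙 (lookup U v ∧ isParentEdge v e)

  leaving : Subset n → Fin m → Bool → ℕ
  leaving U e b =
    𝟙 ((lookup U (source G e b) ∧ not (lookup U (target G e b))) ∧ isParentEdge (source G e b) e)

  ∣∣≡1+∑childIn : ∀ U → lookup U r ≡ true → ∣ U ∣ ≡ suc (∑[ v < n ] ∑[ e < m ] childIn U v e)
  ∣∣≡1+∑childIn U r∈U = begin
    ∣ U ∣
      ≡⟨ ∣∣≡sum U ⟩
    ∑[ v < n ] 𝟙 (u v)
      ≡⟨ sum-cong-≗ (λ v → 𝟙-split (u v) (isRoot v)) ⟩
    ∑[ v < n ] (𝟙 (u v ∧ isRoot v) + 𝟙 (u v ∧ not (isRoot v)))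
      ≡⟨ ∑-distrib-+ (λ v → 𝟙 (u v ∧ isRoot v)) (λ v → 𝟙 (u v ∧ not (isRoot v))) ⟩
    ∑[ v < n ] 𝟙 (u v ∧ isRoot v) + ∑[ v < n ] 𝟙 (u v ∧ not (isRoot v))
      ≡⟨ cong₂ _+_ root-counted (sum-cong-≗ (sym ∘ ∑childIn)) ⟩
    suc (∑[ v < n ] ∑[ e < m ] childIn U v e) ∎
    where
    open ≡-Reasoning
    u : Fin n → Bool
    u = lookup U
    isRoot : Fin n → Bool
    isRoot v = does (r ≟ᶠ v)
    root-counted : ∑[ v < n ] 𝟙 (u v ∧ isRoot v) ≡ 1
    root-counted = trans (sum-select (λ v c → 𝟙 (u v ∧ c)) r (λ v → cong 𝟙 (∧-zeroʳ (u v))))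
                         (cong (λ b → 𝟙 (b ∧ true)) r∈U)
    ∑childIn : ∀ v → ∑[ e < m ] childIn U v e ≡ 𝟙 (u v ∧ not (isRoot v))
    ∑childIn v with u v
    ... | true = parentEdge-count v
    ... | false = sum-zero {f = λ e → 𝟙 (false ∧ isParentEdge v e)} (λ _ → refl)

  ∑childIn≡inner+leaving : ∀ U e →
    ∑[ v < n ] childIn U v e ≡ 𝟙 (isInnerEdge G U T e) + (leaving U e true + leaving U e false)
  ∑childIn≡inner+leaving U e = trans (sum-pair (loopless G e) vanish)
    (𝟙-edge-split (lookup T e) (lookup U (proj₁ (ends G e))) (lookup U (proj₂ (ends G e)))
                  (isParentEdge-endpoints e))
    where
    vanish : ∀ v → v ≢ proj₁ (ends G e) → v ≢ proj₂ (ends G e) → childIn U v e ≡ 0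
    vanish v v≢x v≢y = cong 𝟙 (trans
      (cong (lookup U v ∧_) (isParentEdge-false {v} {e} (λ p → [ v≢x , v≢y ] (parent-endpoint p))))
      (∧-zeroʳ (lookup U v)))

  slack-rooted : ∀ U → lookup U r ≡ true →
    (∣ U ∣ ∸ 1) ∸ edgesInside G U T ≡ ∑[ e < m ] (leaving U e true + leaving U e false)
  slack-rooted U r∈U = begin
    (∣ U ∣ ∸ 1) ∸ edgesInside G U T
      ≡⟨ cong (λ k → (k ∸ 1) ∸ edgesInside G U T) (∣∣≡1+∑childIn U r∈U) ⟩
    ∑[ v < n ] ∑[ e < m ] childIn U v e ∸ edgesInside G U T
      ≡⟨ cong (_∸ edgesInside G U T) (∑-comm (childIn U)) ⟩
    ∑[ e < m ] ∑[ v < n ] childIn U v e ∸ edgesInside G U T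
      ≡⟨ cong (_∸ edgesInside G U T) (sum-cong-≗ (∑childIn≡inner+leaving U)) ⟩
    ∑[ e < m ] (𝟙 (isInnerEdge G U T e) + leaving₂ e) ∸ edgesInside G U T
      ≡⟨ cong (_∸ edgesInside G U T) (∑-distrib-+ (𝟙 ∘ isInnerEdge G U T) leaving₂) ⟩
    (∑[ e < m ] 𝟙 (isInnerEdge G U T e) + ∑[ e < m ] leaving₂ e) ∸ edgesInside G U T
      ≡⟨ cong (λ k → (k + ∑[ e < m ] leaving₂ e) ∸ edgesInside G U T) (sym (edgesInside≡∑ G U T)) ⟩
    (edgesInside G U T + ∑[ e < m ] leaving₂ e) ∸ edgesInside G U T
      ≡⟨ ℕP.m+n∸m≡n (edgesInside G U T) _ ⟩
    ∑[ e < m ] leaving₂ e ∎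
    where
    open ≡-Reasoning
    leaving₂ : Fin m → ℕ
    leaving₂ e = leaving U e true + leaving U e false

module SlackCover {n m} (G : Graph n m) {ts : List (Subset m)} (enum : EnumeratesSpanningTrees G ts) where

  open import Data.List.Membership.DecPropositional (≡-decᵛ {n = m} Bool._≟_) using ()
    renaming (_∈?_ to _∈ₗ?_)

  tree : ∀ {T} → T ∈ₗ ts → IsSpanningTree G T
  tree {T} = Equivalence.to (proj₂ enum T)

  isRootOf : Subset n → Fin n → Bool
  isRootOf U r with nonempty? U
  ... | yes (r₀ , _) = does (r₀ ≟ᶠ r)
  ... | no _ = false

  -- Only members of ts occur as columns; deciding membership supplies the spanning-tree proof.
  isParentArc : Subset m → Fin n → Fin m → Bool → Bool
  isParentArc T r e b with T ∈ₗ? ts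
  ... | yes T∈ts = RootedTree.isParentEdge (tree T∈ts) r (source G e b) e
  ... | no _ = false

  edgeRow : Fin m → Row n m → Bool
  edgeRow e (inj₁ f) = does (f ≟ᶠ e)
  edgeRow e (inj₂ _) = false

  arcRow : Fin n → Fin m → Bool → Row n m → Bool
  arcRow r e b (inj₁ _) = false
  arcRow r e b (inj₂ U) = isRootOf U r ∧ (lookup U (source G e b) ∧ not (lookup U (target G e b)))

  arcCover : Row n m → Subset m → Fin n → ℕ
  arcCover i T r = ∑[ e < m ] (𝟙 (arcRow r e true i ∧ isParentArc T r e true) +
                               𝟙 (arcRow r e false i ∧ isParentArc T r e false))

  slackCover : Row n m → Subset m → ℕ
  slackCover i T = ∑[ e < m ] 𝟙 (edgeRow e i ∧ lookup T e) + ∑[ r < n ] arcCover i T r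

  slackCover-innerAtMost : ∀ X → RankOneFeasible (rows n m) ts X →
                           InnerProductBound.InnerAtMost (rows n m) ts X slackCover
                                                         (m * 1 + n * (m * (1 + 1)))
  slackCover-innerAtMost X feasible =
    innerAtMost-+ (innerAtMost-∑ λ e → rankOne (edgeRow e) (λ T → lookup T e))
                  (innerAtMost-∑ λ r → innerAtMost-∑ λ e →
                    innerAtMost-+ (rankOne (arcRow r e true) (λ T → isParentArc T r e true))
                                  (rankOne (arcRow r e false) (λ T → isParentArc T r e false)))
    where
    open InnerProductBound (rows n m) ts X
    rankOne : ∀ (a : Row n m → Bool) (b : Subset m → Bool) → InnerAtMost (λ i T → 𝟙 (a i ∧ b T)) 1
    rankOne = innerAtMost-rankOne feasible

  -- Rectangles meant for the other kind of row vanish by computation.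
  slack≡slackCover : ∀ i {T} → T ∈ₗ ts → slack G i T ≡ slackCover i T
  slack≡slackCover (inj₁ f) {T} _ = sym (trans (cong₂ _+_
    (sum-select (λ e c → 𝟙 (c ∧ lookup T e)) f (λ _ → refl))
    (sum-zero {n} λ _ → sum-replicate-zero m)) (ℕP.+-identityʳ _))
  slack≡slackCover (inj₂ U) {T} T∈ts with nonempty? U | T ∈ₗ? ts
  ... | _ | no T∉ts = ⊥-elim (T∉ts T∈ts)
  ... | no U-empty | yes _ = trans
    (trans (cong (λ k → (k ∸ 1) ∸ edgesInside G U T) (∣∣≡0 U-empty))
           (ℕP.0∸n≡0 (edgesInside G U T)))
    (sym (cong₂ _+_ (sum-replicate-zero m) (sum-zero {n} λ _ → sum-replicate-zero m)))
  ... | yes (r₀ , r₀∈U) | yes T∈ts′ = trans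
    (slack-rooted U ([]=⇒lookup r₀∈U))
    (sym (cong₂ _+_ (sum-replicate-zero m)
                    (sum-select (λ r c → ∑[ e < m ] (arcTerm c r e true + arcTerm c r e false)) r₀
                                (λ _ → sum-replicate-zero m))))
    where
    open RootedTree (tree T∈ts′) r₀
    arcTerm : Bool → Fin n → Fin m → Bool → ℕ
    arcTerm c r e b = 𝟙 ((c ∧ (lookup U (source G e b) ∧ not (lookup U (target G e b)))) ∧
                         RootedTree.isParentEdge (tree T∈ts′) r (source G e b) e)

module _ {R C : Set} (M : R → C → ℕ) where

  foldr-⊔-≥-init : ∀ i k (cs : List C) → k ≤ foldr (λ j l → M i j ⊔ l) k cs
  foldr-⊔-≥-init i k [] = ℕP.≤-refl
  foldr-⊔-≥-init i k (j ∷ cs) = ℕP.≤-trans (foldr-⊔-≥-init i k cs) (ℕP.m≤n⊔m (M i j) _)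

  foldr-⊔-≥-entry : ∀ i k {j} {cs : List C} → j ∈ₗ cs → M i j ≤ foldr (λ j l → M i j ⊔ l) k cs
  foldr-⊔-≥-entry i k (here refl) = ℕP.m≤m⊔n (M i _) _
  foldr-⊔-≥-entry i k {cs = j′ ∷ _} (there j∈) =
    ℕP.≤-trans (foldr-⊔-≥-entry i k j∈) (ℕP.m≤n⊔m (M i j′) _)

  maxEntry-≥ : ∀ {rs : List R} {cs : List C} {i j} → i ∈ₗ rs → j ∈ₗ cs → M i j ≤ maxEntry rs cs M
  maxEntry-≥ {cs = cs} (here refl) j∈ = foldr-⊔-≥-entry _ _ j∈
  maxEntry-≥ {i′ ∷ _} {cs} (there i∈) j∈ = ℕP.≤-trans (maxEntry-≥ i∈ j∈) (foldr-⊔-≥-init i′ _ cs)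

∈-allSubsets : ∀ {k} (U : Subset k) → U ∈ₗ allSubsets k
∈-allSubsets [] = here refl
∈-allSubsets {suc k} (true ∷ U) = ∈-++⁺ˡ (∈-map⁺ (true ∷_) (∈-allSubsets U))
∈-allSubsets {suc k} (false ∷ U) =
  ∈-++⁺ʳ (map (true ∷_) (allSubsets k)) (∈-map⁺ (false ∷_) (∈-allSubsets U))

∈-rows-edge : ∀ {n m} (e : Fin m) → inj₁ e ∈ₗ rows n m
∈-rows-edge e = ∈-++⁺ˡ (∈-map⁺ inj₁ (∈-allFin e))

∈-rows-set : ∀ {n m} {U : Subset n} → Nonempty U → inj₂ U ∈ₗ rows n m
∈-rows-set {n} {m} {U} U-nonempty =
  ∈-++⁺ʳ (map inj₁ (allFin m)) (∈-map⁺ inj₂ (∈-filter⁺ nonempty? (∈-allSubsets U) U-nonempty))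

module SlackBounds {n m} (G : Graph n m) {ts : List (Subset m)} (enum : EnumeratesSpanningTrees G ts)
                   {T₀ : Subset m} (T₀∈ts : T₀ ∈ₗ ts) where

  open SlackCover G enum using (tree)

  M : ℕ
  M = maxEntry (rows n m) ts (slack G)

  1≤M : Fin m → 1 ≤ M
  1≤M e₀ with Reach-distinct⇒edge (loopless G e₀) (proj₁ (tree T₀∈ts) _ _)
  ... | e , e∈T₀ = subst (_≤ M) (cong 𝟙 e∈T₀) (maxEntry-≥ (slack G) (∈-rows-edge e) T₀∈ts)

  ∣∣≤1+M : ∀ U → edgesInside G U T₀ ≡ 0 → ∣ U ∣ ≤ suc M
  ∣∣≤1+M U no-inner-edge with nonempty? U
  ... | no U-empty = subst (_≤ suc M) (sym (∣∣≡0 U-empty)) z≤n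
  ... | yes U-nonempty = ℕP.≤-trans (ℕP.m≤n+m∸n ∣ U ∣ 1) (s≤s ∣∣-1≤M)
    where
    ∣∣-1≤M : ∣ U ∣ ∸ 1 ≤ M
    ∣∣-1≤M = subst (λ k → (∣ U ∣ ∸ 1) ∸ k ≤ M) no-inner-edge
                   (maxEntry-≥ (slack G) (∈-rows-set U-nonempty) T₀∈ts)

  n≤2+2M : Fin n → n ≤ suc M + suc M
  n≤2+2M r = begin
    n                                  ≡⟨ sym (ℕP.m+[n∸m]≡n (∣p∣≤n evenDepth)) ⟩
    ∣ evenDepth ∣ + (n ∸ ∣ evenDepth ∣)  ≡⟨ cong (∣ evenDepth ∣ +_) (sym (∣∁p∣≡n∸∣p∣ evenDepth)) ⟩
    ∣ evenDepth ∣ + ∣ ∁ evenDepth ∣     ≤⟨ ℕP.+-mono-≤ (∣∣≤1+M evenDepth edgesInside-evenDepth)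
                                                       (∣∣≤1+M (∁ evenDepth) edgesInside-oddDepth) ⟩
    suc M + suc M                      ∎
    where
    open ℕP.≤-Reasoning
    open RootedTree (tree T₀∈ts) r

coverSize≤ : ∀ m n M → 1 ≤ M → n ≤ suc M + suc M → m * 1 + n * (m * (1 + 1)) ≤ 9 * m * M
coverSize≤ m n M 1≤M n≤ = begin
  m * 1 + n * (m * (1 + 1))  ≡⟨ factor m n ⟩
  m * (1 + 2 * n)            ≤⟨ ℕP.*-monoʳ-≤ m 1+2n≤9M ⟩
  m * (9 * M)                ≡⟨ reassociate m M ⟩
  9 * m * M                  ∎
  where
  open ℕP.≤-Reasoning
  factor : ∀ m n → m * 1 + n * (m * (1 + 1)) ≡ m * (1 + 2 * n)
  factor = solve-∀
  reassociate : ∀ m M → m * (9 * M) ≡ 9 * m * M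
  reassociate = solve-∀
  expand : ∀ M → 1 + 2 * (suc M + suc M) ≡ 5 + 4 * M
  expand = solve-∀
  collect : ∀ M → 5 * M + 4 * M ≡ 9 * M
  collect = solve-∀
  1+2n≤9M : 1 + 2 * n ≤ 9 * M
  1+2n≤9M = begin
    1 + 2 * n                ≤⟨ s≤s (ℕP.*-monoʳ-≤ 2 n≤) ⟩
    1 + 2 * (suc M + suc M)  ≡⟨ expand M ⟩
    5 + 4 * M                ≤⟨ ℕP.+-monoˡ-≤ (4 * M) (ℕP.*-monoʳ-≤ 5 1≤M) ⟩
    5 * M + 4 * M            ≡⟨ collect M ⟩
    9 * M                    ∎

slack-innerAtMost : ∀ {n m} (G : Graph n m) → 0 < m →
                    ∀ {ts} → EnumeratesSpanningTrees G ts →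
                    ∀ X → RankOneFeasible (rows n m) ts X →
                    InnerProductBound.InnerAtMost (rows n m) ts X (slack G)
                                                  (9 * m * maxEntry (rows n m) ts (slack G))
slack-innerAtMost G 0<m {[]} enum X feasible =
  innerAtMost-mono z≤n (innerAtMost-cong (λ _ ()) innerAtMost-zero)
  where open InnerProductBound (rows _ _) [] X
slack-innerAtMost {n} {m} G 0<m {ts@(_ ∷ _)} enum X feasible =
  innerAtMost-mono (coverSize≤ m n M (1≤M e₀) (n≤2+2M (proj₁ (ends G e₀))))
    (innerAtMost-cong (λ {i} _ T∈ts → sym (slack≡slackCover i T∈ts))
                      (slackCover-innerAtMost X feasible))
  where
  open InnerProductBound (rows n m) ts X
  open SlackCover G enum
  open SlackBounds G enum (here refl)
  e₀ : Fin m
  e₀ = Fin.fromℕ< 0<m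

theorem4p1 : Σ[ C ∈ ℕ ] (0 < C ×
    (∀ (n m : ℕ) (G : Graph n m) → Connected G → 0 < m →
     (ts : List (Subset m)) → EnumeratesSpanningTrees G ts →
     (X : Row n m → Subset m → ℚ) → RankOneFeasible (rows n m) ts X →
     inner (rows n m) ts (λ i T → toℚ (slack G i T)) X
       ℚ.≤ toℚ (C * m) ℚ.* toℚ (maxEntry (rows n m) ts (slack G))))
theorem4p1 = 9 , s≤s z≤n , λ n m G _ 0<m ts enum X feasible →
  subst (inner (rows n m) ts (λ i T → toℚ (slack G i T)) X ℚ.≤_) (toℚ-* (9 * m) _)
        (InnerProductBound.inner≤ (slack-innerAtMost G 0<m enum X feasible))
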